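{- Every directed graph $G$ has a subdivision $\tilde G$ that satisfies property (P2).
   Context: A subdivision of a directed graph is obtained by replacing edges $xy$ by directed $x$-$y$-paths with new internal vertices. For an edge $e=uv$ of a directed graph $H$, $P_H(e)$ denotes the subgraph of $H$ induced by all edges lying on directed $u$-$v$-paths in $H$. Property (P2) for $H$: the edge sets $\{E(P_H(e))\}_{e\in E(H)}$ form a laminar family, i.e., for all edges $e_1,e_2\in E(H)$, $P_H(e_1)\subseteq P_H(e_2)$ or $P_H(e_2)\subseteq P_H(e_1)$ or $E(P_H(e_1))\cap E(P_H(e_2))=\emptyset$. -}

module Defs where

open import Data.Nat using (ℕ)
open import Data.Fin using (Fin)
open import Data.Bool using (Bool; true; false; T)
open import Data.List using (List; []; _∷_)
open import Data.List.Membership.Propositional using (_∈_)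
open import Data.List.Relation.Unary.Unique.Propositional using (Unique)
open import Data.Product using (Σ; ∃; _×_; _,_)
open import Data.Sum using (_⊎_)
open import Relation.Binary.PropositionalEquality using (_≡_; _≢_)
open import Relation.Nullary using (¬_)
open import Function.Definitions using (Injective)

-- A finite (simple) directed graph: vertex set Fin V, an adjacency relation,
-- no loops.  (Antiparallel edges u→v, v→u are allowed; no parallel edges.)
record Digraph : Set where
  field
    V     : ℕ
    adj   : Fin V → Fin V → Bool
    loopless : ∀ x → adj x x ≡ false

open Digraph public

Edge : (H : Digraph) → Fin (V H) → Fin (V H) → Set
Edge H a b = T (adj H a b)

data Walk (H : Digraph) : Fin (V H) → Fin (V H) → Set where
  stop : ∀ {x} → Walk H x x
  step : ∀ {x y z} → Edge H x y → Walk H y z → Walk H x z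

verts : ∀ {H x y} → Walk H x y → List (Fin (V H))
verts {x = x} stop = x ∷ []
verts {x = x} (step e w) = x ∷ verts w

initVerts : ∀ {H x y} → Walk H x y → List (Fin (V H))
initVerts stop = []
initVerts {x = x} (step e w) = x ∷ initVerts w

interior : ∀ {H x y} → Walk H x y → List (Fin (V H))
interior stop = []
interior (step e w) = initVerts w

record Path (H : Digraph) (x y : Fin (V H)) : Set where
  constructor mkPath
  field
    walk     : Walk H x y
    distinct : Unique (verts walk)

open Path public

data OnWalk {H : Digraph} (a b : Fin (V H)) : ∀ {x y} → Walk H x y → Set where
  here  : ∀ {z} (e : Edge H a b) (w : Walk H b z) → OnWalk a b (step e w)
  there : ∀ {x y z} (e : Edge H x y) {w : Walk H y z} → OnWalk a b w → OnWalk a b (step e w)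

-- edge a→b belongs to P_H(e) for e = u→v: it lies on some directed u-v-path
InP : (H : Digraph) (u v a b : Fin (V H)) → Set
InP H u v a b = Σ (Path H u v) λ p → OnWalk a b (walk p)

-- Property (P2): the edge sets of the P_H(e), e ∈ E(H), form a laminar family
P2 : Digraph → Set
P2 H = ∀ u₁ v₁ u₂ v₂ → Edge H u₁ v₁ → Edge H u₂ v₂ →
         (∀ a b → Edge H a b → InP H u₁ v₁ a b → InP H u₂ v₂ a b)
       ⊎ (∀ a b → Edge H a b → InP H u₂ v₂ a b → InP H u₁ v₁ a b)
       ⊎ (∀ a b → Edge H a b → ¬ (InP H u₁ v₁ a b × InP H u₂ v₂ a b))

-- H is (isomorphic to) a subdivision of G: branch vertices φ(x), and for each
-- edge u→v of G a directed φ(u)-φ(v)-path π in H, such that the paths partition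
-- E(H), are internally disjoint and avoid branch vertices internally, and every
-- vertex of H is a branch vertex or internal to some π.
record Subdivision (G H : Digraph) : Set where
  field
    φ      : Fin (V G) → Fin (V H)
    φ-inj  : Injective _≡_ _≡_ φ
    π      : ∀ u v → Edge G u v → Path H (φ u) (φ v)
    covers : ∀ a b → Edge H a b →
               Σ (Fin (V G)) λ u → Σ (Fin (V G)) λ v → Σ (Edge G u v) λ p →
                 OnWalk a b (walk (π u v p))
    edge-unique : ∀ u v p u' v' p' a b →
               OnWalk a b (walk (π u v p)) → OnWalk a b (walk (π u' v' p')) →
               (u ≡ u') × (v ≡ v')
    interior-not-branch : ∀ u v p x → x ∈ interior (walk (π u v p)) →
               ∀ w → φ w ≢ x
    interior-disjoint : ∀ u v p u' v' p' x → x ∈ interior (walk (π u v p)) →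
               x ∈ verts (walk (π u' v' p')) → (u ≡ u') × (v ≡ v')
    vertex-covers : ∀ x → (Σ (Fin (V G)) λ w → φ w ≡ x)
               ⊎ (Σ (Fin (V G)) λ u → Σ (Fin (V G)) λ v → Σ (Edge G u v) λ p →
                    x ∈ interior (walk (π u v p)))

{-# OPTIONS --safe #-}
module Submission where

-- It suffices to subdivide every arc of G once, by a new vertex m. In the
-- subdivision every arc is either x → m, where x is the only in-neighbour of m,
-- or m → y, where y is the only out-neighbour of m; either way a directed path
-- between the ends of such an arc is the arc itself. So each P_H(e) consists of
-- e alone, and single edges form a laminar family.

open import Defs
open import Axiom.UniquenessOfIdentityProofs using (module Decidable⇒UIP)
open import Data.Bool using (Bool; false; T)
open import Data.Bool.Properties using (T?)
open import Data.Empty using (⊥-elim)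
open import Data.Fin using (Fin; zero; suc; _↑ˡ_; _↑ʳ_; splitAt; _≟_)
open import Data.Fin.Properties
  using (splitAt-↑ˡ; splitAt-↑ʳ; splitAt⁻¹-↑ˡ; splitAt⁻¹-↑ʳ; ↑ˡ-injective; ↑ʳ-injective)
open import Data.List using (List; []; _∷_; filter; cartesianProduct; allFin; length; lookup)
open import Data.List.Membership.Propositional using (_∈_)
open import Data.List.Membership.Propositional.Properties
  using (∈-filter⁺; ∈-filter⁻; ∈-cartesianProduct⁺; ∈-allFin; ∈-lookup)
open import Data.List.Membership.Setoid.Properties using (unique⇒irrelevant)
open import Data.List.Relation.Unary.All using ([]; _∷_)
open import Data.List.Relation.Unary.AllPairs using ([]; _∷_)
open import Data.List.Relation.Unary.Any using (here; there; index)
open import Data.List.Relation.Unary.Any.Properties using (lookup-index)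
open import Data.List.Relation.Unary.Unique.Propositional using (Unique)
open import Data.List.Relation.Unary.Unique.Propositional.Properties
  using (filter⁺; cartesianProduct⁺; allFin⁺; Unique[x∷xs]⇒x∉xs)
open import Data.Nat using (ℕ; _+_)
open import Data.Product using (Σ; _×_; _,_; proj₁; proj₂)
open import Data.Product.Properties using (≡-dec; ,-injectiveˡ; ,-injectiveʳ)
open import Data.Sum using (_⊎_; inj₁; inj₂)
open import Function using (_∘_)
open import Relation.Binary.PropositionalEquality
open import Relation.Nullary using (Dec; ¬_; yes; no; contradiction)
open import Relation.Nullary.Decidable using (⌊_⌋; toWitness; fromWitness)

index-∈-lookup : ∀ {A : Set} (xs : List A) i → index (∈-lookup {xs = xs} i) ≡ i
index-∈-lookup (x ∷ xs) zero    = refl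
index-∈-lookup (x ∷ xs) (suc i) = cong suc (index-∈-lookup xs i)

SoleArc : (H : Digraph) → Fin (V H) → Fin (V H) → Set
SoleArc H u v = (∀ y → Edge H u y → y ≡ v) ⊎ (∀ x → Edge H x v → x ≡ u)

module _ {H : Digraph} where

  last∈verts : ∀ {x y} (w : Walk H x y) → y ∈ verts w
  last∈verts stop       = here refl
  last∈verts (step e w) = there (last∈verts w)

  here-≡ : ∀ {a b x y z} → a ≡ x → b ≡ y → (e : Edge H x y) (w : Walk H y z) → OnWalk a b (step e w)
  here-≡ refl refl = here

  closedPath-arcless : ∀ {v a b} (w : Walk H v v) → Unique (verts w) → ¬ OnWalk a b w
  closedPath-arcless (step e w) distinct _ = Unique[x∷xs]⇒x∉xs distinct (last∈verts w)

  solePred-visited : ∀ {u v} → (∀ x → Edge H x v → x ≡ u) →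
                     ∀ {y} (w : Walk H y v) → y ≡ v ⊎ u ∈ verts w
  solePred-visited solePred stop = inj₁ refl
  solePred-visited solePred (step e w) with solePred-visited solePred w
  ... | inj₁ refl = inj₂ (here (sym (solePred _ e)))
  ... | inj₂ u∈w  = inj₂ (there u∈w)

  soleArc-firstStep : ∀ {u v y} → SoleArc H u v → Edge H u y → (w : Walk H y v) →
                      Unique (u ∷ verts w) → y ≡ v
  soleArc-firstStep (inj₁ soleSucc) e w distinct = soleSucc _ e
  soleArc-firstStep (inj₂ solePred) e w distinct with solePred-visited solePred w
  ... | inj₁ y≡v = y≡v
  ... | inj₂ u∈w = contradiction u∈w (Unique[x∷xs]⇒x∉xs distinct)

  soleArc-InP : ∀ {u v a b} → SoleArc H u v → InP H u v a b → a ≡ u × b ≡ v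
  soleArc-InP sole (mkPath (step e w) distinct , onWalk)
    with soleArc-firstStep sole e w distinct
  soleArc-InP sole (mkPath (step e w) distinct , here _ _) | refl = refl , refl
  soleArc-InP sole (mkPath (step e w) (_ ∷ distinct) , there _ onWalk) | refl =
    contradiction onWalk (closedPath-arcless w distinct)

  singletonP⇒P2 : (∀ {u v a b} → Edge H u v → InP H u v a b → a ≡ u × b ≡ v) → P2 H
  singletonP⇒P2 ends u₁ v₁ u₂ v₂ e₁ e₂ with u₁ ≟ u₂ | v₁ ≟ v₂
  ... | yes refl | yes refl = inj₁ λ _ _ _ inP → inP
  ... | no u₁≢u₂ | _        = inj₂ (inj₂ λ _ _ _ (inP₁ , inP₂) →
    u₁≢u₂ (trans (sym (proj₁ (ends e₁ inP₁))) (proj₁ (ends e₂ inP₂))))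
  ... | _        | no v₁≢v₂ = inj₂ (inj₂ λ _ _ _ (inP₁ , inP₂) →
    v₁≢v₂ (trans (sym (proj₂ (ends e₁ inP₁))) (proj₂ (ends e₂ inP₂))))

module Arcs (G : Digraph) where

  Arc : Set
  Arc = Fin (V G) × Fin (V G)

  IsArc : Arc → Set
  IsArc (u , v) = Edge G u v

  isArc? : ∀ a → Dec (IsArc a)
  isArc? (u , v) = T? (adj G u v)

  pairs : List Arc
  pairs = cartesianProduct (allFin (V G)) (allFin (V G))

  arcs : List Arc
  arcs = filter isArc? pairs

  ∈-arcs : ∀ {u v} → Edge G u v → (u , v) ∈ arcs
  ∈-arcs {u} {v} = ∈-filter⁺ isArc? (∈-cartesianProduct⁺ (∈-allFin u) (∈-allFin v))

  ∈-arcs-irrelevant : ∀ {a} (p q : a ∈ arcs) → p ≡ q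
  ∈-arcs-irrelevant = unique⇒irrelevant (setoid Arc) (Decidable⇒UIP.≡-irrelevant (≡-dec _≟_ _≟_))
    (filter⁺ isArc? {xs = pairs} (cartesianProduct⁺ (allFin⁺ _) (allFin⁺ _)))

  #arcs : ℕ
  #arcs = length arcs

  arcAt : Fin #arcs → Arc
  arcAt = lookup arcs

  arcAt-isArc : ∀ j → IsArc (arcAt j)
  arcAt-isArc j = proj₂ (∈-filter⁻ isArc? {xs = pairs} (∈-lookup j))

  slot : ∀ {u v} → Edge G u v → Fin #arcs
  slot e = index (∈-arcs e)

  arcAt-slot : ∀ {u v} (e : Edge G u v) → arcAt (slot e) ≡ (u , v)
  arcAt-slot e = sym (lookup-index (∈-arcs e))

  slot-arcAt : ∀ j → slot (arcAt-isArc j) ≡ j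
  slot-arcAt j = trans (cong index (∈-arcs-irrelevant _ (∈-lookup j))) (index-∈-lookup arcs j)

  slot-injective : ∀ {u v u' v'} (e : Edge G u v) (e' : Edge G u' v') →
                   slot e ≡ slot e' → u ≡ u' × v ≡ v'
  slot-injective {u} {v} {u'} {v'} e e' eq = ,-injectiveˡ sameArc , ,-injectiveʳ sameArc
    where
    sameArc : (u , v) ≡ (u' , v')
    sameArc = trans (sym (arcAt-slot e)) (trans (cong arcAt eq) (arcAt-slot e'))

module OneSubdivision (G : Digraph) where

  open Arcs G

  n : ℕ
  n = V G

  link : Fin n ⊎ Fin #arcs → Fin n ⊎ Fin #arcs → Bool
  link (inj₁ a) (inj₂ j) = ⌊ a ≟ proj₁ (arcAt j) ⌋
  link (inj₂ j) (inj₁ b) = ⌊ b ≟ proj₂ (arcAt j) ⌋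
  link (inj₁ _) (inj₁ _) = false
  link (inj₂ _) (inj₂ _) = false

  link-irreflexive : ∀ x → link x x ≡ false
  link-irreflexive (inj₁ _) = refl
  link-irreflexive (inj₂ _) = refl

  H : Digraph
  H = record
    { V        = n + #arcs
    ; adj      = λ x y → link (splitAt n x) (splitAt n y)
    ; loopless = λ x → link-irreflexive (splitAt n x)
    }

  branch : Fin n → Fin (V H)
  branch a = a ↑ˡ #arcs

  mid : Fin #arcs → Fin (V H)
  mid j = n ↑ʳ j

  branch-injective : ∀ {a b} → branch a ≡ branch b → a ≡ b
  branch-injective = ↑ˡ-injective #arcs _ _

  mid-injective : ∀ {i j} → mid i ≡ mid j → i ≡ j
  mid-injective = ↑ʳ-injective n _ _

  branch≢mid : ∀ a j → branch a ≢ mid j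
  branch≢mid a j eq
    with trans (sym (splitAt-↑ˡ n a #arcs)) (trans (cong (splitAt n) eq) (splitAt-↑ʳ n #arcs j))
  ... | ()

  data Vertex : Fin (V H) → Set where
    isBranch : ∀ a → Vertex (branch a)
    isMid    : ∀ j → Vertex (mid j)

  vertex : ∀ x → Vertex x
  vertex x with splitAt n x in eq
  ... | inj₁ a = subst Vertex (splitAt⁻¹-↑ˡ eq) (isBranch a)
  ... | inj₂ j = subst Vertex (splitAt⁻¹-↑ʳ eq) (isMid j)

  Edge-branch-mid : ∀ a j → Edge H (branch a) (mid j) → a ≡ proj₁ (arcAt j)
  Edge-branch-mid a j e rewrite splitAt-↑ˡ n a #arcs | splitAt-↑ʳ n #arcs j = toWitness e

  Edge-mid-branch : ∀ j b → Edge H (mid j) (branch b) → b ≡ proj₂ (arcAt j)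
  Edge-mid-branch j b e rewrite splitAt-↑ˡ n b #arcs | splitAt-↑ʳ n #arcs j = toWitness e

  ¬Edge-branch-branch : ∀ a b → ¬ Edge H (branch a) (branch b)
  ¬Edge-branch-branch a b e rewrite splitAt-↑ˡ n a #arcs | splitAt-↑ˡ n b #arcs = e

  ¬Edge-mid-mid : ∀ i j → ¬ Edge H (mid i) (mid j)
  ¬Edge-mid-mid i j e rewrite splitAt-↑ʳ n #arcs i | splitAt-↑ʳ n #arcs j = e

  tail-edge : ∀ {u v} (e : Edge G u v) → Edge H (branch u) (mid (slot e))
  tail-edge {u} e rewrite splitAt-↑ˡ n u #arcs | splitAt-↑ʳ n #arcs (slot e) =
    fromWitness (sym (cong proj₁ (arcAt-slot e)))

  head-edge : ∀ {u v} (e : Edge G u v) → Edge H (mid (slot e)) (branch v)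
  head-edge {v = v} e rewrite splitAt-↑ˡ n v #arcs | splitAt-↑ʳ n #arcs (slot e) =
    fromWitness (sym (cong proj₂ (arcAt-slot e)))

  path : ∀ {u v} → Edge G u v → Path H (branch u) (branch v)
  path {u} {v} e = mkPath (step (tail-edge e) (step (head-edge e) stop))
    ((branch≢mid u _ ∷ u≢v ∘ branch-injective ∷ []) ∷ ((branch≢mid v _ ∘ sym) ∷ []) ∷ [] ∷ [])
    where
    u≢v : u ≢ v
    u≢v refl = subst T (loopless G u) e

  onPath : ∀ {u v a b} (e : Edge G u v) → OnWalk a b (walk (path e)) →
           (a ≡ branch u × b ≡ mid (slot e)) ⊎ (a ≡ mid (slot e) × b ≡ branch v)
  onPath e (here _ _)              = inj₁ (refl , refl)
  onPath e (there _ (here _ _))    = inj₂ (refl , refl)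
  onPath e (there _ (there _ ()))

  covers : ∀ a b → Edge H a b → Σ (Fin n) λ u → Σ (Fin n) λ v → Σ (Edge G u v) λ e →
             OnWalk a b (walk (path e))
  covers a b e with vertex a | vertex b
  ... | isBranch x | isBranch y = ⊥-elim (¬Edge-branch-branch x y e)
  ... | isMid i    | isMid j    = ⊥-elim (¬Edge-mid-mid i j e)
  ... | isBranch x | isMid j    = _ , _ , arcAt-isArc j ,
    here-≡ (cong branch (Edge-branch-mid x j e)) (cong mid (sym (slot-arcAt j))) _ _
  ... | isMid j    | isBranch y = _ , _ , arcAt-isArc j ,
    there _ (here-≡ (cong mid (sym (slot-arcAt j))) (cong branch (Edge-mid-branch j y e)) _ _)

  edge-unique : ∀ u v e u' v' e' a b → OnWalk a b (walk (path {u} {v} e)) →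
                OnWalk a b (walk (path {u'} {v'} e')) → u ≡ u' × v ≡ v'
  edge-unique u v e u' v' e' a b on on' with onPath e on | onPath e' on'
  ... | inj₁ (_ , b≡) | inj₁ (_ , b≡')  = slot-injective e e' (mid-injective (trans (sym b≡) b≡'))
  ... | inj₂ (a≡ , _) | inj₂ (a≡' , _)  = slot-injective e e' (mid-injective (trans (sym a≡) a≡'))
  ... | inj₁ (a≡ , _) | inj₂ (a≡' , _)  = ⊥-elim (branch≢mid u _ (trans (sym a≡) a≡'))
  ... | inj₂ (a≡ , _) | inj₁ (a≡' , _)  = ⊥-elim (branch≢mid u' _ (trans (sym a≡') a≡))

  interior-not-branch : ∀ u v e x → x ∈ interior (walk (path {u} {v} e)) → ∀ w → branch w ≢ x
  interior-not-branch u v e _ (here refl) w = branch≢mid w _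

  interior-disjoint : ∀ u v e u' v' e' x → x ∈ interior (walk (path {u} {v} e)) →
                      x ∈ verts (walk (path {u'} {v'} e')) → u ≡ u' × v ≡ v'
  interior-disjoint u v e u' v' e' _ (here refl) (here eq)                 = ⊥-elim (branch≢mid u' _ (sym eq))
  interior-disjoint u v e u' v' e' _ (here refl) (there (here eq))         = slot-injective e e' (mid-injective eq)
  interior-disjoint u v e u' v' e' _ (here refl) (there (there (here eq))) = ⊥-elim (branch≢mid v' _ (sym eq))

  vertex-covers : ∀ x → (Σ (Fin n) λ w → branch w ≡ x)
                  ⊎ (Σ (Fin n) λ u → Σ (Fin n) λ v → Σ (Edge G u v) λ e → x ∈ interior (walk (path e)))
  vertex-covers x with vertex x
  ... | isBranch a = inj₁ (a , refl)
  ... | isMid j    = inj₂ (_ , _ , arcAt-isArc j , here (cong mid (sym (slot-arcAt j))))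

  subdivision : Subdivision G H
  subdivision = record
    { φ                   = branch
    ; φ-inj               = branch-injective
    ; π                   = λ _ _ → path
    ; covers              = covers
    ; edge-unique         = edge-unique
    ; interior-not-branch = interior-not-branch
    ; interior-disjoint   = interior-disjoint
    ; vertex-covers       = vertex-covers
    }

  soleArc : ∀ x y → Edge H x y → SoleArc H x y
  soleArc x y e with vertex x | vertex y
  ... | isBranch a | isBranch b = ⊥-elim (¬Edge-branch-branch a b e)
  ... | isMid i    | isMid j    = ⊥-elim (¬Edge-mid-mid i j e)
  ... | isBranch a | isMid j    = inj₂ solePred
    where
    solePred : ∀ z → Edge H z (mid j) → z ≡ branch a
    solePred z e' with vertex z
    ... | isBranch c = cong branch (trans (Edge-branch-mid c j e') (sym (Edge-branch-mid a j e)))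
    ... | isMid i    = ⊥-elim (¬Edge-mid-mid i j e')
  ... | isMid j    | isBranch b = inj₁ soleSucc
    where
    soleSucc : ∀ z → Edge H (mid j) z → z ≡ branch b
    soleSucc z e' with vertex z
    ... | isBranch c = cong branch (trans (Edge-mid-branch j c e') (sym (Edge-mid-branch j b e)))
    ... | isMid i    = ⊥-elim (¬Edge-mid-mid j i e')

theorem4 : (G : Digraph) → Σ Digraph λ H → Subdivision G H × P2 H
theorem4 G = H , subdivision , singletonP⇒P2 (λ e → soleArc-InP (soleArc _ _ e))
  where open OneSubdivision G
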